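{- Let $\rho$ be a polymatroid on a finite set $E$, and let $\mathcal{Y}_\rho$ be its set of cyclic sets. (1) If $X,Y\in\mathcal{Y}_\rho$, then $X\cup Y\in\mathcal{Y}_\rho$; thus, ordered by inclusion, $\mathcal{Y}_\rho$ is a lattice. (2) If $X\in\mathcal{Y}_\rho$, then $\mathrm{cl}_\rho(X)\in\mathcal{Y}_\rho$, and so $\mathrm{cl}_\rho(X)$ is a cyclic flat of $\rho$.
   Context: A polymatroid on a finite set $E$ is a function $\rho:2^E\to\mathbb{R}$ with $\rho(\emptyset)=0$, monotone and submodular. $A\subseteq E$ is a flat if $\rho(A\cup\{i\})>\rho(A)$ for all $i\in E-A$; $A$ is cyclic if $\rho(A)<\rho(A-\{i\})+\rho(\{i\})$ for all $i\in A$ with $\rho(\{i\})>0$; a cyclic flat is a set that is both. $\mathrm{cl}_\rho(A)$ is the intersection of all flats containing $A$. -}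

module Defs where

open import Level using (0ℓ)
open import Data.Nat using (ℕ)
open import Data.Fin using (Fin)
open import Data.Fin.Subset using (Subset; _∈_; _∉_; _⊆_; _∪_; _∩_; _-_; ⁅_⁆; ⊥)
open import Data.Product using (_×_)
open import Relation.Binary.PropositionalEquality using (_≡_; _≢_)
open import Relation.Binary.Structures using (IsTotalOrder)
open import Algebra.Structures using (IsAbelianGroup)

-- Agda's standard library has no real numbers, so we state the result for
-- every totally ordered abelian group, which includes (ℝ, +, ≤).
record OrderedAbGroup : Set₁ where
  infixl 6 _+_
  infix 4 _≤_ _<_
  field
    Carrier        : Set
    _+_            : Carrier → Carrier → Carrier
    0#             : Carrier
    neg            : Carrier → Carrier
    _≤_            : Carrier → Carrier → Set
    isAbelianGroup : IsAbelianGroup _≡_ _+_ 0# neg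
    isTotalOrder   : IsTotalOrder _≡_ _≤_
    +-mono-≤       : ∀ {x y} z → x ≤ y → x + z ≤ y + z

  _<_ : Carrier → Carrier → Set
  x < y = (x ≤ y) × (x ≢ y)

module _ (G : OrderedAbGroup) {n : ℕ} (ρ : Subset n → OrderedAbGroup.Carrier G) where
  open OrderedAbGroup G

  record IsPolymatroid : Set where
    field
      empty      : ρ ⊥ ≡ 0#
      monotone   : ∀ {A B} → A ⊆ B → ρ A ≤ ρ B
      submodular : ∀ A B → ρ (A ∪ B) + ρ (A ∩ B) ≤ ρ A + ρ B

  Flat : Subset n → Set
  Flat A = ∀ i → i ∉ A → ρ A < ρ (A ∪ ⁅ i ⁆)

  Cyclic : Subset n → Set
  Cyclic A = ∀ i → i ∈ A → 0# < ρ ⁅ i ⁆ → ρ A < ρ (A - i) + ρ ⁅ i ⁆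

  IsClosureOf : Subset n → Subset n → Set
  IsClosureOf A C = ∀ i → (i ∈ C → ∀ F → Flat F → A ⊆ F → i ∈ F)
                        × ((∀ F → Flat F → A ⊆ F → i ∈ F) → i ∈ C)

{-# OPTIONS --safe #-}
-- Call i a coloop of A when ρ A = ρ (A - i) + ρ ⁅ i ⁆.  Submodularity always
-- gives ≤ here, so A is cyclic iff no i ∈ A with ρ ⁅ i ⁆ > 0 is a coloop of A.
-- Submodularity for X and U - i shows that a coloop of U lying in X ⊆ U is a
-- coloop of X.  Hence every superset of a cyclic set X has no coloops of
-- positive rank inside X, which gives (1) and the elements of X in cl(X).
--
-- Submodularity for a flat F and C ∪ ⁅ i ⁆ with C ⊆ F shows that F contains
-- every i with ρ (C ∪ ⁅ i ⁆) = ρ C; so cl(X) is a flat.  If some i ∈ cl(X) - X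
-- with ρ ⁅ i ⁆ > 0 were a coloop of cl(X), removing it would lower the rank,
-- so cl(X) - i would again be a flat containing X, contradicting minimality.
module Submission where

open import Defs
open import Data.Nat using (ℕ)
open import Data.Fin using (Fin)
open import Data.Fin.Properties using (_≟_)
open import Data.Fin.Subset
  using (Subset; _∈_; _∉_; _⊆_; _∪_; _∩_; _─_; _-_; ⁅_⁆; inside; outside)
  renaming (⊥ to ∅)
open import Data.Fin.Subset.Properties
open import Data.Vec using (_∷_; here; there)
open import Data.Product using (_×_; _,_; proj₁; proj₂)
open import Data.Sum using ([_,_]′; inj₁; inj₂; map₂)
open import Function using (_∘_)
open import Relation.Nullary using (¬_; yes; no)
open import Relation.Nullary.Decidable using (decidable-stable)
open import Relation.Binary.PropositionalEquality using (_≡_; _≢_; refl; sym; trans; cong; subst; subst₂)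
open import Relation.Binary.Structures using (IsTotalOrder)
open import Algebra.Bundles using (AbelianGroup)
import Algebra.Properties.AbelianGroup as AbelianGroupProperties
import Algebra.Properties.CommutativeSemigroup as CommutativeSemigroupProperties

x∈p─q⇒x∉q : ∀ {n} {x : Fin n} (p q : Subset n) → x ∈ p ─ q → x ∉ q
x∈p─q⇒x∉q (inside ∷ p) (outside ∷ q) here      ()
x∈p─q⇒x∉q (_      ∷ p) (_       ∷ q) (there x∈) (there x∈q) = x∈p─q⇒x∉q p q x∈ x∈q

module _ {n : ℕ} where

  x∈p-y⇒x≢y : ∀ {p : Subset n} {x y} → x ∈ p - y → x ≢ y
  x∈p-y⇒x≢y {p} {y = y} x∈ refl = x∈p─q⇒x∉q p ⁅ y ⁆ x∈ (x∈⁅x⁆ y)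

  x∉p-x : ∀ {p : Subset n} {x} → x ∉ p - x
  x∉p-x x∈ = x∈p-y⇒x≢y x∈ refl

  ∪-monoʳ-⊆ : ∀ {p q r : Subset n} → q ⊆ r → p ∪ q ⊆ p ∪ r
  ∪-monoʳ-⊆ {p} {q} q⊆r x∈ = x∈p∪q⁺ (map₂ q⊆r (x∈p∪q⁻ p q x∈))

  p⊆q⇒p-x⊆q-x : ∀ {p q : Subset n} {x} → p ⊆ q → p - x ⊆ q - x
  p⊆q⇒p-x⊆q-x {p} {x = x} p⊆q y∈ =
    x∈p∧x≢y⇒x∈p-y (p⊆q (p─q⊆p p ⁅ x ⁆ y∈)) (x∈p-y⇒x≢y y∈)

  x∉p∧p⊆q⇒p⊆q-x : ∀ {p q : Subset n} {x} → x ∉ p → p ⊆ q → p ⊆ q - x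
  x∉p∧p⊆q⇒p⊆q-x x∉p p⊆q y∈p = x∈p∧x≢y⇒x∈p-y (p⊆q y∈p) λ { refl → x∉p y∈p }

  x∈p⇒q⊆p∪[q-x] : ∀ {p q : Subset n} {x} → x ∈ p → q ⊆ p ∪ (q - x)
  x∈p⇒q⊆p∪[q-x] {x = x} x∈p {y} y∈q with y ≟ x
  ... | yes refl = x∈p∪q⁺ (inj₁ x∈p)
  ... | no y≢x   = x∈p∪q⁺ (inj₂ (x∈p∧x≢y⇒x∈p-y y∈q y≢x))

  ⊆-∩ : ∀ {p q r : Subset n} → r ⊆ p → r ⊆ q → r ⊆ p ∩ q
  ⊆-∩ r⊆p r⊆q x∈r = x∈p∩q⁺ (r⊆p x∈r , r⊆q x∈r)

  p⊆[p-x]∪⁅x⁆ : ∀ {p : Subset n} {x} → p ⊆ (p - x) ∪ ⁅ x ⁆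
  p⊆[p-x]∪⁅x⁆ {p} {x} =
    ⊆-trans (x∈p⇒q⊆p∪[q-x] (x∈⁅x⁆ x)) (⊆-reflexive (∪-comm ⁅ x ⁆ (p - x)))

module OrderedAbGroupProperties (G : OrderedAbGroup) where
  open OrderedAbGroup G

  abelianGroup : AbelianGroup _ _
  abelianGroup = record { isAbelianGroup = isAbelianGroup }

  open AbelianGroup abelianGroup public using (comm; identityʳ)
  open IsTotalOrder isTotalOrder public using (antisym; reflexive) renaming (trans to ≤-trans)
  open AbelianGroupProperties abelianGroup public using (identityʳ-unique; //-rightDividesʳ)
  open CommutativeSemigroupProperties (AbelianGroup.commutativeSemigroup abelianGroup) public
    using (xy∙z≈zy∙x)

  +-cancelʳ-≤ : ∀ {a b} c → a + c ≤ b + c → a ≤ b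
  +-cancelʳ-≤ {a} {b} c a+c≤b+c =
    subst₂ _≤_ (//-rightDividesʳ c a) (//-rightDividesʳ c b) (+-mono-≤ (neg c) a+c≤b+c)

  +-mono₂-≤ : ∀ {a b c d} → a ≤ b → c ≤ d → a + c ≤ b + d
  +-mono₂-≤ {a} {b} {c} {d} a≤b c≤d =
    ≤-trans (+-mono-≤ c a≤b) (subst₂ _≤_ (comm c b) (comm d b) (+-mono-≤ b c≤d))

module Polymatroid (G : OrderedAbGroup) {n : ℕ} {ρ : Subset n → OrderedAbGroup.Carrier G}
                   (polymatroid : IsPolymatroid G ρ) where
  open OrderedAbGroup G
  open OrderedAbGroupProperties G
  open IsPolymatroid polymatroid

  Coloop : Subset n → Fin n → Set
  Coloop A i = ρ A ≡ ρ (A - i) + ρ ⁅ i ⁆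

  submodular-⊆ : ∀ {A B P Q} → P ⊆ A ∪ B → Q ⊆ A → Q ⊆ B → ρ P + ρ Q ≤ ρ A + ρ B
  submodular-⊆ {A} {B} P⊆A∪B Q⊆A Q⊆B =
    ≤-trans (+-mono₂-≤ (monotone P⊆A∪B) (monotone (⊆-∩ Q⊆A Q⊆B))) (submodular A B)

  ρp≤ρ[p-x]+ρ⁅x⁆ : ∀ A i → ρ A ≤ ρ (A - i) + ρ ⁅ i ⁆
  ρp≤ρ[p-x]+ρ⁅x⁆ A i = subst (_≤ ρ (A - i) + ρ ⁅ i ⁆) ρA+ρ∅≡ρA
    (submodular-⊆ p⊆[p-x]∪⁅x⁆ (⊥⊆ {p = A - i}) (⊥⊆ {p = ⁅ i ⁆}))
    where
    ρA+ρ∅≡ρA : ρ A + ρ ∅ ≡ ρ A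
    ρA+ρ∅≡ρA = trans (cong (ρ A +_) empty) (identityʳ (ρ A))

  cyclic⁺ : ∀ {A} → (∀ i → i ∈ A → 0# < ρ ⁅ i ⁆ → ¬ Coloop A i) → Cyclic G ρ A
  cyclic⁺ {A} no-coloop i i∈A 0<ρi = ρp≤ρ[p-x]+ρ⁅x⁆ A i , no-coloop i i∈A 0<ρi

  coloop-⊆ : ∀ {X U i} → i ∈ X → X ⊆ U → Coloop U i → Coloop X i
  coloop-⊆ {X} {U} {i} i∈X X⊆U U-coloop =
    antisym (ρp≤ρ[p-x]+ρ⁅x⁆ X i) (+-cancelʳ-≤ (ρ (U - i)) submod)
    where
    submod : ρ (X - i) + ρ ⁅ i ⁆ + ρ (U - i) ≤ ρ X + ρ (U - i)
    submod = subst (_≤ ρ X + ρ (U - i))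
      (trans (cong (_+ ρ (X - i)) U-coloop) (xy∙z≈zy∙x (ρ (U - i)) (ρ ⁅ i ⁆) (ρ (X - i))))
      (submodular-⊆ (x∈p⇒q⊆p∪[q-x] i∈X) (p─q⊆p X ⁅ i ⁆) (p⊆q⇒p-x⊆q-x X⊆U))

  cyclic-⊆⇒¬coloop : ∀ {X U i} → Cyclic G ρ X → i ∈ X → X ⊆ U → 0# < ρ ⁅ i ⁆ → ¬ Coloop U i
  cyclic-⊆⇒¬coloop X-cyclic i∈X X⊆U 0<ρi = proj₂ (X-cyclic _ i∈X 0<ρi) ∘ coloop-⊆ i∈X X⊆U

  ∪-cyclic : ∀ X Y → Cyclic G ρ X → Cyclic G ρ Y → Cyclic G ρ (X ∪ Y)
  ∪-cyclic X Y X-cyclic Y-cyclic = cyclic⁺ λ i i∈X∪Y 0<ρi →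
    [ (λ i∈X → cyclic-⊆⇒¬coloop X-cyclic i∈X (p⊆p∪q Y) 0<ρi)
    , (λ i∈Y → cyclic-⊆⇒¬coloop Y-cyclic i∈Y (q⊆p∪q X Y) 0<ρi)
    ]′ (x∈p∪q⁻ X Y i∈X∪Y)

  coloop⇒ρ[p-x]≢ρp : ∀ {A i} → 0# < ρ ⁅ i ⁆ → Coloop A i → ρ (A - i) ≢ ρ A
  coloop⇒ρ[p-x]≢ρp {A} {i} (_ , 0≢ρi) A-coloop ρ[A-i]≡ρA =
    0≢ρi (sym (identityʳ-unique (ρ (A - i)) (ρ ⁅ i ⁆) (trans (sym A-coloop) (sym ρ[A-i]≡ρA))))

  flat-closed : ∀ {F C i} → Flat G ρ F → C ⊆ F → ρ C ≡ ρ (C ∪ ⁅ i ⁆) → i ∈ F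
  flat-closed {F} {C} {i} F-flat C⊆F ρC≡ρ[C∪i] = decidable-stable (i ∈? F) λ i∉F →
    let (ρF≤ρ[F∪i] , ρF≢ρ[F∪i]) = F-flat i i∉F
    in ρF≢ρ[F∪i] (antisym ρF≤ρ[F∪i] (+-cancelʳ-≤ (ρ C) submod))
    where
    submod : ρ (F ∪ ⁅ i ⁆) + ρ C ≤ ρ F + ρ C
    submod = subst (λ r → ρ (F ∪ ⁅ i ⁆) + ρ C ≤ ρ F + r) (sym ρC≡ρ[C∪i])
      (submodular-⊆ (∪-monoʳ-⊆ (q⊆p∪q C ⁅ i ⁆)) C⊆F (p⊆p∪q ⁅ i ⁆))

  flat-remove : ∀ {D i} → Flat G ρ D → i ∈ D → ρ (D - i) ≢ ρ D → Flat G ρ (D - i)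
  flat-remove {D} {i} D-flat i∈D ρ[D-i]≢ρD j j∉D-i with j ≟ i
  ... | yes refl = monotone (p⊆p∪q ⁅ i ⁆) , λ ρ[D-i]≡ρ[D-i∪i] →
    ρ[D-i]≢ρD (antisym (monotone (p─q⊆p D ⁅ i ⁆))
                        (≤-trans (monotone p⊆[p-x]∪⁅x⁆) (reflexive (sym ρ[D-i]≡ρ[D-i∪i]))))
  ... | no j≢i = monotone (p⊆p∪q ⁅ j ⁆) , λ ρ[D-i]≡ρ[D-i∪j] →
    j∉D-i (x∈p∧x≢y⇒x∈p-y (flat-closed D-flat (p─q⊆p D ⁅ i ⁆) ρ[D-i]≡ρ[D-i∪j]) j≢i)

  module Closure {X C} (C-closure : IsClosureOf G ρ X C) where

    X⊆C : X ⊆ C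
    X⊆C x∈X = proj₂ (C-closure _) λ _ _ X⊆F → X⊆F x∈X

    C⊆flat : ∀ {F} → Flat G ρ F → X ⊆ F → C ⊆ F
    C⊆flat F-flat X⊆F x∈C = proj₁ (C-closure _) x∈C _ F-flat X⊆F

    closure-flat : Flat G ρ C
    closure-flat i i∉C = monotone (p⊆p∪q ⁅ i ⁆) , λ ρC≡ρ[C∪i] →
      i∉C (proj₂ (C-closure i) λ F F-flat X⊆F → flat-closed F-flat (C⊆flat F-flat X⊆F) ρC≡ρ[C∪i])

    closure-cyclic : Cyclic G ρ X → Cyclic G ρ C
    closure-cyclic X-cyclic = cyclic⁺ no-coloop
      where
      no-coloop : ∀ i → i ∈ C → 0# < ρ ⁅ i ⁆ → ¬ Coloop C i
      no-coloop i i∈C 0<ρi C-coloop with i ∈? X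
      ... | yes i∈X = cyclic-⊆⇒¬coloop X-cyclic i∈X X⊆C 0<ρi C-coloop
      ... | no i∉X  = x∉p-x (C⊆flat C-i-flat (x∉p∧p⊆q⇒p⊆q-x i∉X X⊆C) i∈C)
        where
        C-i-flat : Flat G ρ (C - i)
        C-i-flat = flat-remove closure-flat i∈C (coloop⇒ρ[p-x]≢ρp 0<ρi C-coloop)

lemma5p10 : (G : OrderedAbGroup) (n : ℕ) (ρ : Subset n → OrderedAbGroup.Carrier G)
    → IsPolymatroid G ρ
    → (∀ X Y → Cyclic G ρ X → Cyclic G ρ Y → Cyclic G ρ (X ∪ Y))
    × (∀ X C → Cyclic G ρ X → IsClosureOf G ρ X C → Cyclic G ρ C × Flat G ρ C)
lemma5p10 G _ _ polymatroid =
  ∪-cyclic , λ X C X-cyclic C-closure → closure-cyclic C-closure X-cyclic , closure-flat C-closure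
  where
  open Polymatroid G polymatroid
  open Closure
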